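{- Let $(a_n)_{n\ge 1}$ be defined by $a_1=1$, $a_2=2$ and $a_{n+1}=n\,a_n+a_{n-1}$ for $n\ge 2$. For each $n\ge 1$, the largest positive integer which has a legal decomposition using only the terms $a_1,\dots,a_n$ is $a_{n+1}-1$.
   Context: A legal decomposition using the terms $a_1,\dots,a_n$ is a sum $\sum_{i=1}^n s_i a_i$ with $s_i\in\{0,1,\ldots,i\}$ and such that if $s_i=i$ then $s_{i-1}=0$. -}

module Defs where

open import Data.Nat using (ℕ; zero; suc; _+_; _*_; _≤_)
open import Relation.Binary.PropositionalEquality using (_≡_)
open import Data.Fin using (Fin; toℕ)
open import Data.Vec using (Vec; lookup; []; _∷_)
open import Data.Product using (Σ; _×_)

-- The sequence a_n (1-indexed): a 1 = 1, a 2 = 2, a (n+1) = n * a n + a (n-1) for n ≥ 2.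
-- The value a 0 = 0 is a dummy and is never used by the statement.
a : ℕ → ℕ
a zero = 0
a (suc zero) = 1
a (suc (suc zero)) = 2
a (suc (suc (suc k))) = suc (suc k) * a (suc (suc k)) + a (suc k)

-- A coefficient vector s : Vec ℕ n stores s_i at position i-1 (i = 1..n).
-- Legal: s_i ∈ {0,…,i}, and if s_i = i then s_{i-1} = 0 (for i ≥ 2).
record Legal (n : ℕ) (s : Vec ℕ n) : Set where
  field
    bound : ∀ (j : Fin n) → lookup s j ≤ suc (toℕ j)
    block : ∀ (j : Fin n) (j' : Fin n) → toℕ j' ≡ suc (toℕ j) →
            lookup s j' ≡ suc (toℕ j') → lookup s j ≡ 0

value : ∀ {n} → Vec ℕ n → ℕ
value {n} s = go n s 1
  where
  go : ∀ m → Vec ℕ m → ℕ → ℕ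
  go zero [] i = 0
  go (suc m) (x ∷ xs) i = x * a i + go m xs (suc i)

HasLegalDecomp : ℕ → ℕ → Set
HasLegalDecomp n m = Σ (Vec ℕ n) (λ s → Legal n s × value s ≡ m)

{-# OPTIONS --safe #-}
module Submission where

-- Peeling off the last digit s_n: if s_n < n, induction bounds the value by
-- a_n + (n-1) a_n ≤ a_{n+1}; if s_n = n, legality forces s_{n-1} = 0, and induction
-- bounds it by a_{n-1} + n a_n = a_{n+1}. The digits n, 0, n-2, 0, … attain the bound,
-- as the recurrence telescopes to a_{n+1} - 1.

open import Defs
open import Data.Nat using (ℕ; zero; suc; _+_; _*_; _∸_; _≤_; _<_; z≤n; s≤s; s≤s⁻¹)
open import Data.Nat.Properties
open import Data.Product using (_×_; _,_; proj₁)
open import Data.Empty using (⊥-elim)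
open import Data.Fin using (Fin; toℕ; inject₁; fromℕ) renaming (zero to fzero; suc to fsuc)
open import Data.Fin.Properties using (toℕ<n; toℕ-inject₁; toℕ-fromℕ)
open import Data.Vec using (Vec; []; _∷_; _∷ʳ_; lookup; initLast)
open import Relation.Binary.PropositionalEquality
open import Relation.Nullary using (yes; no)

*a≤a-suc : ∀ n → suc n * a (suc n) ≤ a (suc (suc n))
*a≤a-suc zero    = s≤s z≤n
*a≤a-suc (suc n) = m≤m+n (suc (suc n) * a (suc (suc n))) (a (suc n))

a-suc-mono : ∀ n → a (suc n) ≤ a (suc (suc n))
a-suc-mono n = ≤-trans (m≤n*m (a (suc n)) (suc n)) (*a≤a-suc n)

2≤a : ∀ n → 2 ≤ a (suc (suc n))
2≤a zero    = ≤-refl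
2≤a (suc n) = ≤-trans (2≤a n) (a-suc-mono (suc n))

-- `value` is defined through a helper local to Defs; unification recovers it
-- (the `with` turns the literal 1 into a variable, making the problem a pattern).
mutual
  valueFrom : ℕ → ∀ {m} → Vec ℕ m → ℕ
  valueFrom = _

  value≡valueFrom : ∀ {m} (xs : Vec ℕ m) → value xs ≡ valueFrom 1 xs
  value≡valueFrom with 1
  ... | _ = λ _ → refl

valueFrom-∷ʳ : ∀ i {m} (xs : Vec ℕ m) x → valueFrom i (xs ∷ʳ x) ≡ valueFrom i xs + x * a (i + m)
valueFrom-∷ʳ i []       x rewrite +-identityʳ i = +-identityʳ (x * a i)
valueFrom-∷ʳ i {suc m} (y ∷ xs) x = begin
  y * a i + valueFrom (suc i) (xs ∷ʳ x)
    ≡⟨ cong (y * a i +_) (valueFrom-∷ʳ (suc i) xs x) ⟩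
  y * a i + (valueFrom (suc i) xs + x * a (suc i + m))
    ≡⟨ sym (+-assoc (y * a i) (valueFrom (suc i) xs) _) ⟩
  y * a i + valueFrom (suc i) xs + x * a (suc i + m)
    ≡⟨ cong (λ k → y * a i + valueFrom (suc i) xs + x * a k) (sym (+-suc i m)) ⟩
  y * a i + valueFrom (suc i) xs + x * a (i + suc m) ∎
  where open ≡-Reasoning

value-∷ʳ : ∀ {m} (xs : Vec ℕ m) x → value (xs ∷ʳ x) ≡ value xs + x * a (suc m)
value-∷ʳ = valueFrom-∷ʳ 1

data InitOrLast : ∀ {n} → Fin (suc n) → Set where
  init : ∀ {n} (k : Fin n) → InitOrLast (inject₁ k)
  last : ∀ {n} → InitOrLast (fromℕ n)

initOrLast : ∀ {n} (j : Fin (suc n)) → InitOrLast j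
initOrLast {zero}  fzero = last
initOrLast {suc n} fzero = init fzero
initOrLast {suc n} (fsuc j) with initOrLast j
... | init k = init (fsuc k)
... | last   = last

lookup-∷ʳ-inject₁ : ∀ {n} (xs : Vec ℕ n) x (k : Fin n) → lookup (xs ∷ʳ x) (inject₁ k) ≡ lookup xs k
lookup-∷ʳ-inject₁ (_ ∷ _)  x fzero    = refl
lookup-∷ʳ-inject₁ (_ ∷ xs) x (fsuc k) = lookup-∷ʳ-inject₁ xs x k

lookup-∷ʳ-fromℕ : ∀ {n} (xs : Vec ℕ n) x → lookup (xs ∷ʳ x) (fromℕ n) ≡ x
lookup-∷ʳ-fromℕ []       x = refl
lookup-∷ʳ-fromℕ (_ ∷ xs) x = lookup-∷ʳ-fromℕ xs x

LastVanishes : ∀ {n} → Vec ℕ n → Set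
LastVanishes {n} xs = ∀ (k : Fin n) → suc (toℕ k) ≡ n → lookup xs k ≡ 0

lastVanishes-∷ʳ-0 : ∀ {n} (xs : Vec ℕ n) → LastVanishes (xs ∷ʳ 0)
lastVanishes-∷ʳ-0 {n} xs k e with initOrLast k
... | init k′ rewrite toℕ-inject₁ k′ = ⊥-elim (<-irrefl (suc-injective e) (toℕ<n k′))
... | last    = lookup-∷ʳ-fromℕ xs 0

lastVanishes-∷ʳ⁻ : ∀ {n} (xs : Vec ℕ n) x → LastVanishes (xs ∷ʳ x) → x ≡ 0
lastVanishes-∷ʳ⁻ {n} xs x vanish =
  trans (sym (lookup-∷ʳ-fromℕ xs x)) (vanish (fromℕ n) (cong suc (toℕ-fromℕ n)))

open Legal

legal-∷ʳ⁺ : ∀ {n} {xs : Vec ℕ n} {x} → Legal n xs → x ≤ suc n →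
            (x ≡ suc n → LastVanishes xs) → Legal (suc n) (xs ∷ʳ x)
bound (legal-∷ʳ⁺ {n} {xs} {x} L x≤ _) j with initOrLast j
... | init k rewrite lookup-∷ʳ-inject₁ xs x k | toℕ-inject₁ k = bound L k
... | last   rewrite lookup-∷ʳ-fromℕ xs x | toℕ-fromℕ n = x≤
block (legal-∷ʳ⁺ {n} {xs} {x} L _ vanish) j j′ e full with initOrLast j | initOrLast j′
... | init k | init k′
  rewrite lookup-∷ʳ-inject₁ xs x k | lookup-∷ʳ-inject₁ xs x k′ | toℕ-inject₁ k | toℕ-inject₁ k′ =
  block L k k′ e full
... | init k | last
  rewrite lookup-∷ʳ-inject₁ xs x k | lookup-∷ʳ-fromℕ xs x | toℕ-inject₁ k | toℕ-fromℕ n =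
  vanish full k (sym e)
... | last | init k′ rewrite toℕ-inject₁ k′ | toℕ-fromℕ n =
  ⊥-elim (<-asym (toℕ<n k′) (≤-reflexive (sym e)))
... | last | last rewrite toℕ-fromℕ n = ⊥-elim (1+n≢n (sym e))

legal-∷ʳ⁻ : ∀ {n} {xs : Vec ℕ n} {x} → Legal (suc n) (xs ∷ʳ x) →
            Legal n xs × x ≤ suc n × (x ≡ suc n → LastVanishes xs)
legal-∷ʳ⁻ {n} {xs} {x} L = legal-init , last-bound , last-block
  where
  legal-init : Legal n xs
  bound legal-init k with bound L (inject₁ k)
  ... | b rewrite lookup-∷ʳ-inject₁ xs x k | toℕ-inject₁ k = b
  block legal-init k k′ e full with block L (inject₁ k) (inject₁ k′)
  ... | b rewrite lookup-∷ʳ-inject₁ xs x k | lookup-∷ʳ-inject₁ xs x k′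
                | toℕ-inject₁ k | toℕ-inject₁ k′ = b e full

  last-bound : x ≤ suc n
  last-bound with bound L (fromℕ n)
  ... | b rewrite lookup-∷ʳ-fromℕ xs x | toℕ-fromℕ n = b

  last-block : x ≡ suc n → LastVanishes xs
  last-block full k e with block L (inject₁ k) (fromℕ n)
  ... | b rewrite lookup-∷ʳ-inject₁ xs x k | lookup-∷ʳ-fromℕ xs x
                | toℕ-inject₁ k | toℕ-fromℕ n = b (sym e) full

maxDecomp : ∀ n → Vec ℕ n
maxDecomp zero          = []
maxDecomp (suc zero)    = 1 ∷ []
maxDecomp (suc (suc n)) = maxDecomp n ∷ʳ 0 ∷ʳ suc (suc n)

maxDecomp-legal : ∀ n → Legal n (maxDecomp n)
maxDecomp-legal zero          = record { bound = λ () ; block = λ () }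
maxDecomp-legal (suc zero)    = record { bound = λ { fzero → ≤-refl } ; block = λ { fzero fzero () } }
maxDecomp-legal (suc (suc n)) =
  legal-∷ʳ⁺ (legal-∷ʳ⁺ (maxDecomp-legal n) z≤n (λ ())) ≤-refl (λ _ → lastVanishes-∷ʳ-0 (maxDecomp n))

value-∷ʳ-0-∷ʳ : ∀ {n} (xs : Vec ℕ n) x → value (xs ∷ʳ 0 ∷ʳ x) ≡ value xs + x * a (suc (suc n))
value-∷ʳ-0-∷ʳ {n} xs x = begin
  value (xs ∷ʳ 0 ∷ʳ x)                      ≡⟨ value-∷ʳ (xs ∷ʳ 0) x ⟩
  value (xs ∷ʳ 0) + x * a (suc (suc n))     ≡⟨ cong (_+ x * a (suc (suc n))) (value-∷ʳ xs 0) ⟩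
  value xs + 0 + x * a (suc (suc n))        ≡⟨ cong (_+ x * a (suc (suc n))) (+-identityʳ (value xs)) ⟩
  value xs + x * a (suc (suc n))            ∎
  where open ≡-Reasoning

suc-value-maxDecomp : ∀ n → suc (value (maxDecomp n)) ≡ a (suc n)
suc-value-maxDecomp zero          = refl
suc-value-maxDecomp (suc zero)    = refl
suc-value-maxDecomp (suc (suc n)) = begin
  suc (value (maxDecomp n ∷ʳ 0 ∷ʳ suc (suc n))) ≡⟨ cong suc (value-∷ʳ-0-∷ʳ (maxDecomp n) (suc (suc n))) ⟩
  suc (value (maxDecomp n)) + X                 ≡⟨ cong (_+ X) (suc-value-maxDecomp n) ⟩
  a (suc n) + X                                 ≡⟨ +-comm (a (suc n)) X ⟩
  X + a (suc n)                                 ∎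
  where
  open ≡-Reasoning
  X = suc (suc n) * a (suc (suc n))

value<a : ∀ {n} (s : Vec ℕ n) → Legal n s → value s < a (suc n)
value<a {zero}  [] _ = s≤s z≤n
value<a {suc n} s  L with initLast s
... | xs , x , refl with legal-∷ʳ⁻ L
... | L′ , x≤ , vanish with x ≟ suc n
... | no x≢ = begin-strict
  value (xs ∷ʳ x)           ≡⟨ value-∷ʳ xs x ⟩
  value xs + x * a (suc n)  <⟨ +-mono-<-≤ (value<a xs L′) (*-monoˡ-≤ (a (suc n)) (s≤s⁻¹ (≤∧≢⇒< x≤ x≢))) ⟩
  suc n * a (suc n)         ≤⟨ *a≤a-suc n ⟩
  a (suc (suc n))           ∎
  where open ≤-Reasoning
value<a {suc zero} s L | [] , _ , refl | _ | yes refl = s≤s (s≤s z≤n)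
value<a {suc (suc n)} s L | xs , _ , refl | L′ , _ , vanish | yes refl with initLast xs
... | ys , y , refl rewrite lastVanishes-∷ʳ⁻ ys y (vanish refl) = begin-strict
  value (ys ∷ʳ 0 ∷ʳ suc (suc n))              ≡⟨ value-∷ʳ-0-∷ʳ ys (suc (suc n)) ⟩
  value ys + suc (suc n) * a (suc (suc n))    <⟨ +-monoˡ-< _ (value<a ys (proj₁ (legal-∷ʳ⁻ L′))) ⟩
  a (suc n) + suc (suc n) * a (suc (suc n))   ≡⟨ +-comm (a (suc n)) _ ⟩
  a (suc (suc (suc n)))                       ∎
  where open ≤-Reasoning

lemma2p1 : ∀ (n : ℕ) → 1 ≤ n →
    (0 < a (suc n) ∸ 1) × HasLegalDecomp n (a (suc n) ∸ 1) ×
    (∀ (m : ℕ) → 0 < m → HasLegalDecomp n m → m ≤ a (suc n) ∸ 1)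
lemma2p1 (suc n) _ =
  ∸-monoˡ-≤ 1 (2≤a n) ,
  (maxDecomp (suc n) , maxDecomp-legal (suc n) , cong (_∸ 1) (suc-value-maxDecomp (suc n))) ,
  λ { m _ (s , L , refl) → ∸-monoˡ-≤ 1 (value<a s L) }
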